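{- Let $q_1,q_2,q_3,q_4$ be positive integers with $(q_1q_2,q_3q_4)=(q_1,q_2)=(q_3,q_4)=1$, and let $l,m,n$ be integers. Then \begin{align*} \lambda(q_1q_2,q_3q_4,l,m,n)&=\lambda\left(q_1,q_3,\,l\,\overline{(q_2q_4)}_{q_1q_3},\,m\,\overline{(q_2q_4)}_{q_1q_3},\,n\,\overline{(q_2q_4)}_{q_1q_3}\right)\\ &\quad\times\lambda\left(q_2,q_4,\,l\,\overline{(q_1q_3)}_{q_2q_4},\,m\,\overline{(q_1q_3)}_{q_2q_4},\,n\,\overline{(q_1q_3)}_{q_2q_4}\right). \end{align*}
   Context: $e(t)=\exp(2\pi i t)$. For positive integers $q_1,q_2$ and integers $l,m,n$, \[ \lambda(q_1,q_2,l,m,n)=\sum_{\substack{1\le x,y,z\le q_1q_2\\ x^2+y^2+z^2+z+1\equiv 0\ (\mathrm{mod}\ q_1)\\ x^2+y^2+z^2+z+2\equiv 0\ (\mathrm{mod}\ q_2)}} e\left(\frac{lx+my+nz}{q_1q_2}\right). \] For integers $a,q$ with $(a,q)=1$, $\overline{a}_q$ denotes an inverse of $a$ modulo $q$. -}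

module Defs where

open import Level using (Level)
open import Data.Nat as ℕ using (ℕ; zero; suc)
open import Data.Nat.Divisibility using (_∣?_)
open import Data.Integer as ℤ using (ℤ; +_; _%ℕ_)
open import Data.List using (List; map; upTo; foldr)
open import Relation.Nullary.Decidable using (does)
open import Data.Bool using (if_then_else_; _∧_)
open import Algebra.Bundles using (CommutativeRing)

-- residue of an integer modulo a natural (convention: 0 when modulus is 0; never used)
modN : ℤ → ℕ → ℕ
modN a zero    = 0
modN a (suc k) = a %ℕ suc k

-- natural division (convention: 0 when divisor is 0; never used)
divN : ℕ → ℕ → ℕ
divN a zero    = 0
divN a (suc k) = a ℕ./ suc k

range1 : ℕ → List ℕ
range1 M = map suc (upTo M)

module _ {c ℓ : Level} (R : CommutativeRing c ℓ) where
  open CommutativeRing R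

  pow : Carrier → ℕ → Carrier
  pow ζ zero    = 1#
  pow ζ (suc k) = ζ * pow ζ k

  sumR : List Carrier → Carrier
  sumR = foldr _+_ 0#

  -- e_ζ(a, M) := ζ^((a mod M) * (Q / M)); for M ∣ Q and ζ = e(1/Q) ∈ ℂ this is e(a/M).
  eR : Carrier → ℕ → ℤ → ℕ → Carrier
  eR ζ Q a M = pow ζ (modN a M ℕ.* divN Q M)

  lam : Carrier → ℕ → ℕ → ℕ → ℤ → ℤ → ℤ → Carrier
  lam ζ Q q₁ q₂ l m n =
    sumR (map (λ x → sumR (map (λ y → sumR (map (λ z → term x y z) (range1 M))) (range1 M))) (range1 M))
    where
    M = q₁ ℕ.* q₂
    term : ℕ → ℕ → ℕ → Carrier
    term x y z =
      let s = x ℕ.* x ℕ.+ y ℕ.* y ℕ.+ z ℕ.* z ℕ.+ z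
      in if does (q₁ ∣? (s ℕ.+ 1)) ∧ does (q₂ ∣? (s ℕ.+ 2))
         then eR ζ Q (l ℤ.* + x ℤ.+ m ℤ.* + y ℤ.+ n ℤ.* + z) M
         else 0#

{-# OPTIONS --safe #-}
module Submission where

-- Put A = q₁q₃ and B = q₂q₄; then uB + vA ≡ 1 (mod AB), and by the Chinese remainder theorem
-- x ↦ (x mod A, x mod B) is a bijection from residues modulo AB onto pairs of residues.
-- Each summand of λ(q₁q₂, q₃q₄) factors through it: as q₁, q₃ ∣ A and q₂, q₄ ∣ B, the condition
-- q₁q₂ ∣ s + 1 splits (q₁, q₂ coprime) into q₁ ∣ s + 1 read modulo A and q₂ ∣ s + 1 read modulo B,
-- likewise for q₃q₄ ∣ s + 2, while e(L/AB) = e(uL/A) e(vL/B) because L ≡ (uL)B + (vL)A (mod AB).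
-- Summing over the three coordinates, the sum of products becomes the product of the two sums.

open import Level using (0ℓ)
open import Function using (_∘_; _⇔_; mk⇔)
open import Data.Bool using (true; false; _∧_; if_then_else_)
open import Data.Bool.Properties using (∧-commutativeMonoid)
open import Data.Product using (_,_; _×_; uncurry)
open import Data.Nat as ℕ using (ℕ; zero; suc; NonZero; _<_; _%_; _/_)
import Data.Nat.Properties as ℕₚ
import Data.Nat.DivMod as ℕDM
open import Data.Nat.Divisibility as ℕD using (_∣_; _∣?_)
open import Data.Nat.Coprimality using (Coprime; coprime-divisor)
import Data.Nat.Tactic.RingSolver as ℕSolver
open import Data.Integer as ℤ using (ℤ; +_; -[1+_]; 1ℤ; 0ℤ; _%ℕ_; _/ℕ_)
import Data.Integer.Properties as ℤₚ
open import Data.Integer.DivMod as ℤDM using (a≡a%ℕn+[a/ℕn]*n)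
import Data.Integer.Divisibility as ℤD
open import Data.Integer.Divisibility.Signed as ℤS using (divides)
open import Data.Integer.Tactic.RingSolver using (solve-∀)
open import Data.Fin as Fin using (Fin; toℕ; fromℕ<; combine; remQuot; _↑ˡ_; _↑ʳ_)
import Data.Fin.Properties as Finₚ
open import Data.Fin.Permutation using (Permutation; permutation)
open import Data.List using (map; applyUpTo)
open import Data.Vec.Functional using (Vector)
open import Relation.Nullary.Decidable using (does; does-⇔; _×-dec_)
open import Relation.Binary.Bundles using (Setoid)
open import Relation.Binary.PropositionalEquality as ≡ using (_≡_)
open import Algebra.Bundles using (CommutativeMonoid; CommutativeRing)
open import Defs

infix 4 _≡_mod_
record _≡_mod_ (a b : ℤ) (d : ℕ) : Set where
  constructor ≡-mod
  field divides-difference : + d ℤS.∣ a ℤ.- b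

module _ {d : ℕ} where

  ≡-mod-reflexive : ∀ {a b} → a ≡ b → a ≡ b mod d
  ≡-mod-reflexive {a} ≡.refl = ≡-mod (divides 0ℤ (lemma a))
    where
    lemma : ∀ a → a ℤ.- a ≡ 0ℤ ℤ.* + d
    lemma = solve-∀

  ≡-mod-refl : ∀ {a} → a ≡ a mod d
  ≡-mod-refl = ≡-mod-reflexive ≡.refl

  ≡-mod-sym : ∀ {a b} → a ≡ b mod d → b ≡ a mod d
  ≡-mod-sym {a} {b} (≡-mod p) = ≡-mod (≡.subst (_ ℤS.∣_) (lemma a b) (ℤS.∣m⇒∣-m p))
    where
    lemma : ∀ a b → ℤ.- (a ℤ.- b) ≡ b ℤ.- a
    lemma = solve-∀

  ≡-mod-trans : ∀ {a b c} → a ≡ b mod d → b ≡ c mod d → a ≡ c mod d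
  ≡-mod-trans {a} {b} {c} (≡-mod p) (≡-mod q) = ≡-mod (≡.subst (_ ℤS.∣_) (lemma a b c) (ℤS.∣m∣n⇒∣m+n p q))
    where
    lemma : ∀ a b c → (a ℤ.- b) ℤ.+ (b ℤ.- c) ≡ a ℤ.- c
    lemma = solve-∀

  ≡-mod-+ : ∀ {a b c e} → a ≡ b mod d → c ≡ e mod d → a ℤ.+ c ≡ b ℤ.+ e mod d
  ≡-mod-+ {a} {b} {c} {e} (≡-mod p) (≡-mod q) = ≡-mod (≡.subst (_ ℤS.∣_) (lemma a b c e) (ℤS.∣m∣n⇒∣m+n p q))
    where
    lemma : ∀ a b c e → (a ℤ.- b) ℤ.+ (c ℤ.- e) ≡ a ℤ.+ c ℤ.- (b ℤ.+ e)
    lemma = solve-∀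

  ≡-mod-* : ∀ {a b c e} → a ≡ b mod d → c ≡ e mod d → a ℤ.* c ≡ b ℤ.* e mod d
  ≡-mod-* {a} {b} {c} {e} (≡-mod p) (≡-mod q) =
    ≡-mod (≡.subst (_ ℤS.∣_) (lemma a b c e) (ℤS.∣m∣n⇒∣m+n (ℤS.∣n⇒∣m*n a q) (ℤS.∣m⇒∣m*n e p)))
    where
    lemma : ∀ a b c e → a ℤ.* (c ℤ.- e) ℤ.+ (a ℤ.- b) ℤ.* e ≡ a ℤ.* c ℤ.- b ℤ.* e
    lemma = solve-∀

  *-modulus≡0 : ∀ k → k ℤ.* + d ≡ 0ℤ mod d
  *-modulus≡0 k = ≡-mod (divides k (ℤₚ.+-identityʳ _))

  %ℕ-≡-mod : ∀ a .{{_ : NonZero d}} → + (a %ℕ d) ≡ a mod d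
  %ℕ-≡-mod a = ≡-mod (divides (ℤ.- (a /ℕ d))
    (≡.trans (≡.cong (λ t → + (a %ℕ d) ℤ.- t) (a≡a%ℕn+[a/ℕn]*n a d)) (lemma (+ (a %ℕ d)) (a /ℕ d) (+ d))))
    where
    lemma : ∀ r q d → r ℤ.- (r ℤ.+ q ℤ.* d) ≡ ℤ.- q ℤ.* d
    lemma = solve-∀

≡-mod-setoid : ℕ → Setoid 0ℓ 0ℓ
≡-mod-setoid d = record
  { Carrier = ℤ
  ; _≈_ = λ a b → a ≡ b mod d
  ; isEquivalence = record { refl = ≡-mod-refl ; sym = ≡-mod-sym ; trans = ≡-mod-trans }
  }

module ≡-mod-Reasoning (d : ℕ) where
  open import Relation.Binary.Reasoning.Setoid (≡-mod-setoid d) public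

≡-mod-∣ : ∀ {k d a b} → k ∣ d → a ≡ b mod d → a ≡ b mod k
≡-mod-∣ k∣d (≡-mod p) = ≡-mod (ℤS.∣-trans (ℤS.∣ᵤ⇒∣ k∣d) p)

≡-mod-*-modulus : ∀ {d a b} e → a ≡ b mod d → a ℤ.* + e ≡ b ℤ.* + e mod d ℕ.* e
≡-mod-*-modulus {d} {a} {b} e (≡-mod (divides k eq)) = ≡-mod (divides k (begin
  a ℤ.* + e ℤ.- b ℤ.* + e ≡⟨ lemma a b (+ e) ⟩
  (a ℤ.- b) ℤ.* + e       ≡⟨ ≡.cong (ℤ._* + e) eq ⟩
  k ℤ.* + d ℤ.* + e       ≡⟨ ℤₚ.*-assoc k (+ d) (+ e) ⟩
  k ℤ.* (+ d ℤ.* + e)     ≡⟨ ≡.cong (k ℤ.*_) (ℤₚ.pos-* d e) ⟨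
  k ℤ.* + (d ℕ.* e)       ∎))
  where
  open ≡.≡-Reasoning
  lemma : ∀ a b e → a ℤ.* e ℤ.- b ℤ.* e ≡ (a ℤ.- b) ℤ.* e
  lemma = solve-∀

-- With e ≡ 1 (mod A) and e ≡ 0 (mod B): a - b = (a - b) e - (a - b)(e - 1), both products divisible by AB.
≡-mod-glue : ∀ {A B} e → e ≡ 1ℤ mod A → e ≡ 0ℤ mod B →
  ∀ {a b} → a ≡ b mod A → a ≡ b mod B → a ≡ b mod A ℕ.* B
≡-mod-glue {A} {B} e (≡-mod (divides s hs)) (≡-mod (divides t ht))
  {a} {b} (≡-mod (divides p hp)) (≡-mod (divides q hq)) =
  ≡-mod (divides (p ℤ.* t ℤ.- q ℤ.* s) (begin
    a ℤ.- b                                                   ≡⟨ split (a ℤ.- b) e ⟩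
    (a ℤ.- b) ℤ.* (e ℤ.- 0ℤ) ℤ.- (a ℤ.- b) ℤ.* (e ℤ.- 1ℤ)    ≡⟨ ≡.cong₂ ℤ._-_ (≡.cong₂ ℤ._*_ hp ht)
                                                                               (≡.cong₂ ℤ._*_ hq hs) ⟩
    p ℤ.* + A ℤ.* (t ℤ.* + B) ℤ.- q ℤ.* + B ℤ.* (s ℤ.* + A)  ≡⟨ regroup p q s t (+ A) (+ B) ⟩
    (p ℤ.* t ℤ.- q ℤ.* s) ℤ.* (+ A ℤ.* + B)                 ≡⟨ ≡.cong (ℤ._*_ (p ℤ.* t ℤ.- q ℤ.* s)) (ℤₚ.pos-* A B) ⟨
    (p ℤ.* t ℤ.- q ℤ.* s) ℤ.* + (A ℕ.* B)                   ∎))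
  where
  open ≡.≡-Reasoning
  split : ∀ d e → d ≡ d ℤ.* (e ℤ.- 0ℤ) ℤ.- d ℤ.* (e ℤ.- 1ℤ)
  split = solve-∀
  regroup : ∀ p q s t A B → p ℤ.* A ℤ.* (t ℤ.* B) ℤ.- q ℤ.* B ℤ.* (s ℤ.* A) ≡ (p ℤ.* t ℤ.- q ℤ.* s) ℤ.* (A ℤ.* B)
  regroup = solve-∀

diff≡*⇒≡+* : ∀ {d} a b k → + a ℤ.- + b ≡ + k ℤ.* + d → a ≡ b ℕ.+ k ℕ.* d
diff≡*⇒≡+* {d} a b k eq = ℤₚ.+-injective (begin
  + a                      ≡⟨ lemma (+ a) (+ b) ⟩
  + b ℤ.+ (+ a ℤ.- + b)    ≡⟨ ≡.cong (ℤ._+_ (+ b)) eq ⟩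
  + b ℤ.+ + k ℤ.* + d      ≡⟨ ≡.cong (ℤ._+_ (+ b)) (ℤₚ.pos-* k d) ⟨
  + b ℤ.+ + (k ℕ.* d)      ≡⟨ ℤₚ.pos-+ b (k ℕ.* d) ⟨
  + (b ℕ.+ k ℕ.* d)        ∎)
  where
  open ≡.≡-Reasoning
  lemma : ∀ a b → a ≡ b ℤ.+ (a ℤ.- b)
  lemma = solve-∀

≡-mod⇒%≡ : ∀ {d a b} .{{_ : NonZero d}} → + a ≡ + b mod d → a % d ≡ b % d
≡-mod⇒%≡ {d} {a} {b} (≡-mod (divides (+ k) eq)) =
  ≡.trans (≡.cong (_% d) (diff≡*⇒≡+* a b k eq)) (ℕDM.[m+kn]%n≡m%n b k d)
≡-mod⇒%≡ {d} {a} {b} (≡-mod (divides -[1+ k ] eq)) =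
  ≡.sym (≡.trans (≡.cong (_% d) (diff≡*⇒≡+* b a (suc k) b-a≡)) (ℕDM.[m+kn]%n≡m%n a (suc k) d))
  where
  open ≡.≡-Reasoning
  lemma : ∀ a b → b ℤ.- a ≡ ℤ.- (a ℤ.- b)
  lemma = solve-∀
  b-a≡ : + b ℤ.- + a ≡ + suc k ℤ.* + d
  b-a≡ = begin
    + b ℤ.- + a              ≡⟨ lemma (+ a) (+ b) ⟩
    ℤ.- (+ a ℤ.- + b)        ≡⟨ ≡.cong ℤ.-_ eq ⟩
    ℤ.- (-[1+ k ] ℤ.* + d)   ≡⟨ ℤₚ.neg-distribˡ-* -[1+ k ] (+ d) ⟩
    + suc k ℤ.* + d          ∎

≡-mod-<⇒≡ : ∀ {d a b} .{{_ : NonZero d}} → a < d → b < d → + a ≡ + b mod d → a ≡ b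
≡-mod-<⇒≡ {d} {a} {b} a<d b<d a≡b = begin
  a      ≡⟨ ℕDM.m<n⇒m%n≡m a<d ⟨
  a % d  ≡⟨ ≡-mod⇒%≡ a≡b ⟩
  b % d  ≡⟨ ℕDM.m<n⇒m%n≡m b<d ⟩
  b      ∎
  where open ≡.≡-Reasoning

∣-respects-≡-mod : ∀ {k d a b} → k ∣ d → + a ≡ + b mod d → k ∣ a → k ∣ b
∣-respects-≡-mod {k} {d} {a} {b} k∣d (≡-mod d∣a-b) k∣a = ℤS.∣⇒∣ᵤ (≡.subst (+ k ℤS.∣_) (lemma (+ a) (+ b))
  (ℤS.∣m∣n⇒∣m-n {m = + a} (ℤS.∣ᵤ⇒∣ k∣a) (ℤS.∣-trans (ℤS.∣ᵤ⇒∣ k∣d) d∣a-b)))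
  where
  lemma : ∀ a b → a ℤ.- (a ℤ.- b) ≡ b
  lemma = solve-∀

-- L/AB ≡ L₁/A + L₂/B modulo 1, i.e. e(L/AB) = e(L₁/A) e(L₂/B).
≡-mod-partial-fractions : ∀ {A B u v L L₁ L₂} → u ℤ.* + B ℤ.+ v ℤ.* + A ≡ 1ℤ mod A ℕ.* B →
  L₁ ≡ u ℤ.* L mod A → L₂ ≡ v ℤ.* L mod B → L ≡ L₁ ℤ.* + B ℤ.+ L₂ ℤ.* + A mod A ℕ.* B
≡-mod-partial-fractions {A} {B} {u} {v} {L} {L₁} {L₂} uB+vA≡1 L₁≡uL L₂≡vL = begin
  L                                    ≡⟨ ℤₚ.*-identityʳ L ⟨
  L ℤ.* 1ℤ                             ≈⟨ ≡-mod-* (≡-mod-refl {a = L}) uB+vA≡1 ⟨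
  L ℤ.* (u ℤ.* + B ℤ.+ v ℤ.* + A)      ≡⟨ distribute L u v (+ A) (+ B) ⟩
  u ℤ.* L ℤ.* + B ℤ.+ v ℤ.* L ℤ.* + A  ≈⟨ ≡-mod-+ (≡-mod-*-modulus B (≡-mod-sym L₁≡uL))
                                                 (≡-mod-*-modulus′ A (≡-mod-sym L₂≡vL)) ⟩
  L₁ ℤ.* + B ℤ.+ L₂ ℤ.* + A            ∎
  where
  open ≡-mod-Reasoning (A ℕ.* B)
  ≡-mod-*-modulus′ : ∀ {d a b} e → a ≡ b mod d → a ℤ.* + e ≡ b ℤ.* + e mod e ℕ.* d
  ≡-mod-*-modulus′ {d} {a} {b} e a≡b = ≡.subst (a ℤ.* + e ≡ b ℤ.* + e mod_) (ℕₚ.*-comm d e) (≡-mod-*-modulus e a≡b)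
  distribute : ∀ L u v A B → L ℤ.* (u ℤ.* B ℤ.+ v ℤ.* A) ≡ u ℤ.* L ℤ.* B ℤ.+ v ℤ.* L ℤ.* A
  distribute = solve-∀

modN-≡-mod : ∀ a M .{{_ : NonZero M}} → + modN a M ≡ a mod M
modN-≡-mod a (suc m) = %ℕ-≡-mod a

divN-*ˡ : ∀ M k .{{_ : NonZero M}} → divN (M ℕ.* k) M ≡ k
divN-*ˡ (suc m) k = ≡.trans (≡.cong (_/ suc m) (ℕₚ.*-comm (suc m) k)) (ℕDM.m*n/n≡m k (suc m))

coprime-*-∣ : ∀ {a b k} → Coprime a b → a ∣ k → b ∣ k → a ℕ.* b ∣ k
coprime-*-∣ {a} {b} {k} a⊥b a∣k (ℕD.divides j k≡jb)
  with coprime-divisor a⊥b (≡.subst (a ∣_) (≡.trans k≡jb (ℕₚ.*-comm j b)) a∣k)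
... | ℕD.divides t j≡ta = ℕD.divides t (≡.trans k≡jb (≡.trans (≡.cong (ℕ._* b) j≡ta) (ℕₚ.*-assoc t a b)))

∣-*-⇔ : ∀ {a b A B k k₁ k₂} → Coprime a b → a ∣ A → b ∣ B →
  + k ≡ + k₁ mod A → + k ≡ + k₂ mod B → a ℕ.* b ∣ k ⇔ (a ∣ k₁ × b ∣ k₂)
∣-*-⇔ {a} {b} a⊥b a∣A b∣B k≡k₁ k≡k₂ = mk⇔
  (λ ab∣k → ∣-respects-≡-mod a∣A k≡k₁ (ℕD.∣-trans (ℕD.m∣m*n b) ab∣k)
          , ∣-respects-≡-mod b∣B k≡k₂ (ℕD.∣-trans (ℕD.n∣m*n a) ab∣k))
  (λ (a∣k₁ , b∣k₂) → coprime-*-∣ a⊥b (∣-respects-≡-mod a∣A (≡-mod-sym k≡k₁) a∣k₁)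
                                     (∣-respects-≡-mod b∣B (≡-mod-sym k≡k₂) b∣k₂))

module RootsOfUnity {c ℓ} (R : CommutativeRing c ℓ) where
  open CommutativeRing R
  open import Algebra.Properties.Semiring.Exp semiring using (_^_; ^-homo-*)
  open import Relation.Binary.Reasoning.Setoid setoid

  pow≡^ : ∀ ζ k → pow R ζ k ≡ ζ ^ k
  pow≡^ ζ zero    = ≡.refl
  pow≡^ ζ (suc k) = ≡.cong (ζ *_) (pow≡^ ζ k)

  pow-homo-+ : ∀ ζ a b → pow R ζ (a ℕ.+ b) ≈ pow R ζ a * pow R ζ b
  pow-homo-+ ζ a b rewrite pow≡^ ζ (a ℕ.+ b) | pow≡^ ζ a | pow≡^ ζ b = ^-homo-* ζ a b

  eR≡pow : ∀ ζ {Q} M k a .{{_ : NonZero M}} → M ℕ.* k ≡ Q → eR R ζ Q a M ≡ pow R ζ (modN a M ℕ.* k)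
  eR≡pow ζ M k a ≡.refl = ≡.cong (λ t → pow R ζ (modN a M ℕ.* t)) (divN-*ˡ M k)

  module _ {ζ Q} (ζ^Q≈1 : pow R ζ Q ≈ 1#) where

    pow-*-order : ∀ k → pow R ζ (k ℕ.* Q) ≈ 1#
    pow-*-order zero    = refl
    pow-*-order (suc k) = begin
      pow R ζ (Q ℕ.+ k ℕ.* Q)        ≈⟨ pow-homo-+ ζ Q (k ℕ.* Q) ⟩
      pow R ζ Q * pow R ζ (k ℕ.* Q)  ≈⟨ *-cong ζ^Q≈1 (pow-*-order k) ⟩
      1# * 1#                        ≈⟨ *-identityˡ 1# ⟩
      1#                             ∎

    pow-% : .{{_ : NonZero Q}} → ∀ a → pow R ζ a ≈ pow R ζ (a % Q)
    pow-% a = begin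
      pow R ζ a                                   ≡⟨ ≡.cong (pow R ζ) (ℕDM.m≡m%n+[m/n]*n a Q) ⟩
      pow R ζ (a % Q ℕ.+ (a / Q) ℕ.* Q)           ≈⟨ pow-homo-+ ζ (a % Q) _ ⟩
      pow R ζ (a % Q) * pow R ζ ((a / Q) ℕ.* Q)   ≈⟨ *-congˡ (pow-*-order (a / Q)) ⟩
      pow R ζ (a % Q) * 1#                        ≈⟨ *-identityʳ _ ⟩
      pow R ζ (a % Q)                             ∎

    pow-cong-mod : .{{_ : NonZero Q}} → ∀ {a b} → + a ≡ + b mod Q → pow R ζ a ≈ pow R ζ b
    pow-cong-mod {a} {b} a≡b = begin
      pow R ζ a        ≈⟨ pow-% a ⟩
      pow R ζ (a % Q)  ≡⟨ ≡.cong (pow R ζ) (≡-mod⇒%≡ a≡b) ⟩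
      pow R ζ (b % Q)  ≈⟨ pow-% b ⟨
      pow R ζ b        ∎

    eR-split : ∀ {A B} .{{_ : NonZero A}} .{{_ : NonZero B}} → A ℕ.* B ≡ Q →
      ∀ {u v} → u ℤ.* + B ℤ.+ v ℤ.* + A ≡ 1ℤ mod A ℕ.* B →
      ∀ {L L₁ L₂} → L₁ ≡ u ℤ.* L mod A → L₂ ≡ v ℤ.* L mod B →
      eR R ζ Q L (A ℕ.* B) ≈ eR R ζ Q L₁ A * eR R ζ Q L₂ B
    eR-split {A} {B} AB≡Q {u} {v} uB+vA≡1 {L} {L₁} {L₂} L₁≡uL L₂≡vL = begin
      eR R ζ Q L (A ℕ.* B)                              ≡⟨ eR≡pow ζ (A ℕ.* B) 1 L (≡.trans (ℕₚ.*-identityʳ _) AB≡Q) ⟩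
      pow R ζ (modN L (A ℕ.* B) ℕ.* 1)                  ≈⟨ pow-cong-mod exponents≡ ⟩
      pow R ζ (m₁ ℕ.* B ℕ.+ m₂ ℕ.* A)                   ≈⟨ pow-homo-+ ζ (m₁ ℕ.* B) (m₂ ℕ.* A) ⟩
      pow R ζ (m₁ ℕ.* B) * pow R ζ (m₂ ℕ.* A)           ≡⟨ ≡.cong₂ _*_ (eR≡pow ζ A B L₁ AB≡Q)
                                                             (eR≡pow ζ B A L₂ (≡.trans (ℕₚ.*-comm B A) AB≡Q)) ⟨
      eR R ζ Q L₁ A * eR R ζ Q L₂ B                     ∎
      where
      instance
        _ : NonZero (A ℕ.* B)
        _ = ℕₚ.m*n≢0 A B
        _ : NonZero Q
        _ = ≡.subst NonZero AB≡Q (ℕₚ.m*n≢0 A B)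
      m₁ = modN L₁ A
      m₂ = modN L₂ B
      casts : + m₁ ℤ.* + B ℤ.+ + m₂ ℤ.* + A ≡ + (m₁ ℕ.* B ℕ.+ m₂ ℕ.* A)
      casts = ≡.sym (≡.trans (ℤₚ.pos-+ (m₁ ℕ.* B) (m₂ ℕ.* A)) (≡.cong₂ ℤ._+_ (ℤₚ.pos-* m₁ B) (ℤₚ.pos-* m₂ A)))
      exponents≡ : + (modN L (A ℕ.* B) ℕ.* 1) ≡ + (m₁ ℕ.* B ℕ.+ m₂ ℕ.* A) mod Q
      exponents≡ = ≡.subst (+ (modN L (A ℕ.* B) ℕ.* 1) ≡ + (m₁ ℕ.* B ℕ.+ m₂ ℕ.* A) mod_) AB≡Q
        (≡-mod-trans (≡-mod-reflexive (≡.cong +_ (ℕₚ.*-identityʳ _)))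
        (≡-mod-trans (modN-≡-mod L (A ℕ.* B))
        (≡-mod-trans (≡-mod-partial-fractions {u = u} {v = v} uB+vA≡1
                       (≡-mod-trans (modN-≡-mod L₁ A) L₁≡uL) (≡-mod-trans (modN-≡-mod L₂ B) L₂≡vL))
                     (≡-mod-reflexive casts))))

module FiniteSums {c ℓ} (R : CommutativeRing c ℓ) where
  open CommutativeRing R
  open import Algebra.Properties.CommutativeMonoid.Sum +-commutativeMonoid
    using (sum; sum-syntax; sum-cong-≋; sum-cong-≗; sum-permute) public
  open import Algebra.Properties.Semiring.Sum semiring using (*-distribˡ-sum; *-distribʳ-sum)
  open import Relation.Binary.Reasoning.Setoid setoid

  sumR-map-applyUpTo : ∀ (g : ℕ → Carrier) (f k : ℕ → ℕ) n →
    sumR R (map g (map f (applyUpTo k n))) ≡ ∑[ i < n ] g (f (k (toℕ i)))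
  sumR-map-applyUpTo g f k zero    = ≡.refl
  sumR-map-applyUpTo g f k (suc n) = ≡.cong (_+_ (g (f (k 0)))) (sumR-map-applyUpTo g f (k ∘ suc) n)

  sumR-range1 : ∀ (g : ℕ → Carrier) n → sumR R (map g (range1 n)) ≡ ∑[ i < n ] g (suc (toℕ i))
  sumR-range1 g = sumR-map-applyUpTo g suc (λ i → i)

  sum-↑ : ∀ m n (h : Vector Carrier (m ℕ.+ n)) →
    sum h ≈ ∑[ i < m ] h (i ↑ˡ n) + ∑[ j < n ] h (m ↑ʳ j)
  sum-↑ zero    n h = sym (+-identityˡ _)
  sum-↑ (suc m) n h = trans (+-congˡ (sum-↑ m n (h ∘ Fin.suc))) (sym (+-assoc _ _ _))

  sum-combine : ∀ m n (h : Vector Carrier (m ℕ.* n)) → sum h ≈ ∑[ i < m ] ∑[ j < n ] h (combine i j)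
  sum-combine zero    n h = refl
  sum-combine (suc m) n h = trans (sum-↑ n (m ℕ.* n) h) (+-congˡ (sum-combine m n (h ∘ (n ↑ʳ_))))

  sum-*-sum : ∀ {m n} (f : Vector Carrier m) (g : Vector Carrier n) →
    sum f * sum g ≈ ∑[ i < m ] ∑[ j < n ] (f i * g j)
  sum-*-sum f g = trans (*-distribʳ-sum (sum g) f) (sum-cong-≋ λ i → *-distribˡ-sum (f i) g)

  cube-sum : ℕ → (ℕ → ℕ → ℕ → Carrier) → Carrier
  cube-sum N F = ∑[ x < N ] ∑[ y < N ] ∑[ z < N ] F (toℕ x) (toℕ y) (toℕ z)

  cube-sum-cong : ∀ N {F G} → (∀ x y z → F x y z ≈ G x y z) → cube-sum N F ≈ cube-sum N G
  cube-sum-cong N F≈G = sum-cong-≋ {N} λ x → sum-cong-≋ {N} λ y → sum-cong-≋ {N} λ z → F≈G (toℕ x) (toℕ y) (toℕ z)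

module ChineseRemainder (A B : ℕ) .{{_ : NonZero A}} .{{_ : NonZero B}} (u v : ℤ)
  (u-inverse : u ℤ.* + B ≡ 1ℤ mod A) (v-inverse : v ℤ.* + A ≡ 1ℤ mod B) where

  instance
    _ : NonZero (A ℕ.* B)
    _ = ℕₚ.m*n≢0 A B

  uB≡0 : u ℤ.* + B ≡ 0ℤ mod B
  uB≡0 = *-modulus≡0 u

  vA≡0 : v ℤ.* + A ≡ 0ℤ mod A
  vA≡0 = *-modulus≡0 v

  ≡-mod-glue-AB : ∀ {a b} → a ≡ b mod A → a ≡ b mod B → a ≡ b mod A ℕ.* B
  ≡-mod-glue-AB = ≡-mod-glue (u ℤ.* + B) u-inverse uB≡0

  uB+vA≡1 : u ℤ.* + B ℤ.+ v ℤ.* + A ≡ 1ℤ mod A ℕ.* B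
  uB+vA≡1 = ≡-mod-glue-AB (≡-mod-trans (≡-mod-+ u-inverse vA≡0) (≡-mod-reflexive (ℤₚ.+-identityʳ 1ℤ)))
                          (≡-mod-trans (≡-mod-+ uB≡0 v-inverse) (≡-mod-reflexive (ℤₚ.+-identityˡ 1ℤ)))

  -- (uB)a + (vA)b is ≡ a (mod A) and ≡ b (mod B).
  crtℤ : ℕ → ℕ → ℤ
  crtℤ a b = u ℤ.* + B ℤ.* + a ℤ.+ v ℤ.* + A ℤ.* + b

  crt : ℕ → ℕ → ℕ
  crt a b = crtℤ a b %ℕ (A ℕ.* B)

  crt<AB : ∀ a b → crt a b < A ℕ.* B
  crt<AB a b = ℤDM.n%ℕd<d (crtℤ a b) (A ℕ.* B)

  crt≡ˡ : ∀ a b → + crt a b ≡ + a mod A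
  crt≡ˡ a b = begin
    + crt a b                          ≈⟨ ≡-mod-∣ (ℕD.m∣m*n B) (%ℕ-≡-mod (crtℤ a b)) ⟩
    u ℤ.* + B ℤ.* + a ℤ.+ v ℤ.* + A ℤ.* + b  ≈⟨ ≡-mod-+ (≡-mod-* u-inverse (≡-mod-refl {a = + a}))
                                                  (≡-mod-* vA≡0 (≡-mod-refl {a = + b})) ⟩
    1ℤ ℤ.* + a ℤ.+ 0ℤ ℤ.* + b          ≡⟨ lemma (+ a) (+ b) ⟩
    + a                                ∎
    where
    open ≡-mod-Reasoning A
    lemma : ∀ a b → 1ℤ ℤ.* a ℤ.+ 0ℤ ℤ.* b ≡ a
    lemma = solve-∀

  crt≡ʳ : ∀ a b → + crt a b ≡ + b mod B
  crt≡ʳ a b = begin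
    + crt a b                                ≈⟨ ≡-mod-∣ (ℕD.n∣m*n A) (%ℕ-≡-mod (crtℤ a b)) ⟩
    u ℤ.* + B ℤ.* + a ℤ.+ v ℤ.* + A ℤ.* + b  ≈⟨ ≡-mod-+ (≡-mod-* uB≡0 (≡-mod-refl {a = + a}))
                                                  (≡-mod-* v-inverse (≡-mod-refl {a = + b})) ⟩
    0ℤ ℤ.* + a ℤ.+ 1ℤ ℤ.* + b                ≡⟨ lemma (+ a) (+ b) ⟩
    + b                                      ∎
    where
    open ≡-mod-Reasoning B
    lemma : ∀ a b → 0ℤ ℤ.* a ℤ.+ 1ℤ ℤ.* b ≡ b
    lemma = solve-∀

  crt-%ˡ : ∀ {a} b → a < A → crt a b % A ≡ a
  crt-%ˡ {a} b a<A = ≡.trans (≡-mod⇒%≡ (crt≡ˡ a b)) (ℕDM.m<n⇒m%n≡m a<A)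

  crt-%ʳ : ∀ a {b} → b < B → crt a b % B ≡ b
  crt-%ʳ a {b} b<B = ≡.trans (≡-mod⇒%≡ (crt≡ʳ a b)) (ℕDM.m<n⇒m%n≡m b<B)

  crt-%-% : ∀ {x} → x < A ℕ.* B → crt (x % A) (x % B) ≡ x
  crt-%-% {x} x<AB = ≡-mod-<⇒≡ (crt<AB _ _) x<AB (≡-mod-glue-AB
    (≡-mod-trans (crt≡ˡ _ _) (%ℕ-≡-mod (+ x)))
    (≡-mod-trans (crt≡ʳ _ _) (%ℕ-≡-mod (+ x))))

  toℕ-mod : ∀ n d .{{_ : NonZero d}} → toℕ (n ℕDM.mod d) ≡ n % d
  toℕ-mod n d = Finₚ.toℕ-fromℕ< _

  reindex : Fin (A ℕ.* B) → Fin (A ℕ.* B)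
  reindex k = combine (toℕ k ℕDM.mod A) (toℕ k ℕDM.mod B)

  reindex-permutation : Permutation (A ℕ.* B) (A ℕ.* B)
  reindex-permutation = permutation reindex reindex⁻¹ reindex∘reindex⁻¹ reindex⁻¹∘reindex
    where
    crtFin : Fin A × Fin B → Fin (A ℕ.* B)
    crtFin (i , j) = fromℕ< (crt<AB (toℕ i) (toℕ j))
    reindex⁻¹ : Fin (A ℕ.* B) → Fin (A ℕ.* B)
    reindex⁻¹ k = crtFin (remQuot B k)
    reindex∘crtFin : ∀ p → reindex (crtFin p) ≡ uncurry combine p
    reindex∘crtFin (i , j) = ≡.cong₂ combine (Finₚ.toℕ-injective residueA) (Finₚ.toℕ-injective residueB)
      where
      toℕ-crtFin : toℕ (crtFin (i , j)) ≡ crt (toℕ i) (toℕ j)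
      toℕ-crtFin = Finₚ.toℕ-fromℕ< _
      residueA : toℕ (toℕ (crtFin (i , j)) ℕDM.mod A) ≡ toℕ i
      residueA = ≡.trans (toℕ-mod _ A) (≡.trans (≡.cong (_% A) toℕ-crtFin) (crt-%ˡ (toℕ j) (Finₚ.toℕ<n i)))
      residueB : toℕ (toℕ (crtFin (i , j)) ℕDM.mod B) ≡ toℕ j
      residueB = ≡.trans (toℕ-mod _ B) (≡.trans (≡.cong (_% B) toℕ-crtFin) (crt-%ʳ (toℕ i) (Finₚ.toℕ<n j)))
    reindex∘reindex⁻¹ : ∀ k → reindex (reindex⁻¹ k) ≡ k
    reindex∘reindex⁻¹ k = ≡.trans (reindex∘crtFin (remQuot B k)) (Finₚ.combine-remQuot {A} B k)
    reindex⁻¹∘reindex : ∀ k → reindex⁻¹ (reindex k) ≡ k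
    reindex⁻¹∘reindex k = ≡.trans (≡.cong crtFin (Finₚ.remQuot-combine (toℕ k ℕDM.mod A) (toℕ k ℕDM.mod B)))
      (Finₚ.toℕ-injective (≡.trans (Finₚ.toℕ-fromℕ< _)
        (≡.trans (≡.cong₂ crt (toℕ-mod (toℕ k) A) (toℕ-mod (toℕ k) B)) (crt-%-% (Finₚ.toℕ<n k)))))

  module _ {c ℓ} (R : CommutativeRing c ℓ) where
    open CommutativeRing R
    open FiniteSums R
    open import Relation.Binary.Reasoning.Setoid setoid

    sum-crt : ∀ (f g : ℕ → Carrier) →
      ∑[ k < A ℕ.* B ] (f (toℕ k % A) * g (toℕ k % B)) ≈ ∑[ i < A ] f (toℕ i) * ∑[ j < B ] g (toℕ j)
    sum-crt f g = begin
      ∑[ k < A ℕ.* B ] (f (toℕ k % A) * g (toℕ k % B))  ≡⟨ sum-cong-≗ H∘reindex ⟨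
      ∑[ k < A ℕ.* B ] H (reindex k)                          ≈⟨ sum-permute H reindex-permutation ⟨
      ∑[ k < A ℕ.* B ] H k                              ≈⟨ sum-combine A B H ⟩
      ∑[ i < A ] ∑[ j < B ] H (combine i j)             ≡⟨ sum-cong-≗ (λ i → sum-cong-≗ (λ j →
                                                             ≡.cong (uncurry h) (Finₚ.remQuot-combine i j))) ⟩
      ∑[ i < A ] ∑[ j < B ] h i j                       ≈⟨ sum-*-sum {A} {B} (f ∘ toℕ) (g ∘ toℕ) ⟨
      ∑[ i < A ] f (toℕ i) * ∑[ j < B ] g (toℕ j)       ∎
      where
      h : Fin A → Fin B → Carrier
      h i j = f (toℕ i) * g (toℕ j)
      H : Fin (A ℕ.* B) → Carrier
      H = uncurry h ∘ remQuot B
      H∘reindex : ∀ k → H (reindex k) ≡ f (toℕ k % A) * g (toℕ k % B)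
      H∘reindex k = ≡.trans (≡.cong (uncurry h) (Finₚ.remQuot-combine _ _))
                (≡.cong₂ (λ a b → f a * g b) (toℕ-mod (toℕ k) A) (toℕ-mod (toℕ k) B))

    cube-sum-crt : ∀ (F G : ℕ → ℕ → ℕ → Carrier) →
      cube-sum (A ℕ.* B) (λ x y z → F (x % A) (y % A) (z % A) * G (x % B) (y % B) (z % B)) ≈
      cube-sum A F * cube-sum B G
    cube-sum-crt F G = begin
      cube-sum (A ℕ.* B) (λ x y z → F (x % A) (y % A) (z % A) * G (x % B) (y % B) (z % B))
        ≈⟨ sum-cong-≋ {A ℕ.* B} (λ x → sum-cong-≋ {A ℕ.* B} λ y →
             sum-crt (F (toℕ x % A) (toℕ y % A)) (G (toℕ x % B) (toℕ y % B))) ⟩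
      ∑[ x < A ℕ.* B ] ∑[ y < A ℕ.* B ]
        (∑[ c < A ] F (toℕ x % A) (toℕ y % A) (toℕ c) * ∑[ c < B ] G (toℕ x % B) (toℕ y % B) (toℕ c))
        ≈⟨ sum-cong-≋ {A ℕ.* B} (λ x →
             sum-crt (λ b → ∑[ c < A ] F (toℕ x % A) b (toℕ c)) (λ b → ∑[ c < B ] G (toℕ x % B) b (toℕ c))) ⟩
      ∑[ x < A ℕ.* B ]
        (∑[ b < A ] ∑[ c < A ] F (toℕ x % A) (toℕ b) (toℕ c) * ∑[ b < B ] ∑[ c < B ] G (toℕ x % B) (toℕ b) (toℕ c))
        ≈⟨ sum-crt (λ a → ∑[ b < A ] ∑[ c < A ] F a (toℕ b) (toℕ c))
                   (λ a → ∑[ b < B ] ∑[ c < B ] G a (toℕ b) (toℕ c)) ⟩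
      cube-sum A F * cube-sum B G ∎

quadric : ℕ → ℕ → ℕ → ℕ
quadric x y z = x ℕ.* x ℕ.+ y ℕ.* y ℕ.+ z ℕ.* z ℕ.+ z

linearForm : ℤ → ℤ → ℤ → ℕ → ℕ → ℕ → ℤ
linearForm l m n x y z = l ℤ.* + x ℤ.+ m ℤ.* + y ℤ.+ n ℤ.* + z

quadric-cong : ∀ {d x y z x′ y′ z′} → + x ≡ + x′ mod d → + y ≡ + y′ mod d → + z ≡ + z′ mod d →
  + quadric x y z ≡ + quadric x′ y′ z′ mod d
quadric-cong {d} {x} {y} {z} {x′} {y′} {z′} x≡ y≡ z≡ = ≡.subst₂ (_≡_mod d) (cast x y z) (cast x′ y′ z′)
  (≡-mod-+ (≡-mod-+ (≡-mod-+ (≡-mod-* x≡ x≡) (≡-mod-* y≡ y≡)) (≡-mod-* z≡ z≡)) z≡)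
  where
  cast : ∀ x y z → + x ℤ.* + x ℤ.+ + y ℤ.* + y ℤ.+ + z ℤ.* + z ℤ.+ + z ≡ + quadric x y z
  cast x y z = ≡.cong (ℤ._+ + z)
    (≡.cong₂ ℤ._+_ (≡.cong₂ ℤ._+_ (≡.sym (ℤₚ.pos-* x x)) (≡.sym (ℤₚ.pos-* y y))) (≡.sym (ℤₚ.pos-* z z)))

linearForm-scale : ∀ {d} l m n u {x y z x′ y′ z′} → + x ≡ + x′ mod d → + y ≡ + y′ mod d → + z ≡ + z′ mod d →
  linearForm (l ℤ.* u) (m ℤ.* u) (n ℤ.* u) x′ y′ z′ ≡ u ℤ.* linearForm l m n x y z mod d
linearForm-scale l m n u {x} {y} {z} x≡ y≡ z≡ = ≡-mod-trans
  (≡-mod-+ (≡-mod-+ (≡-mod-* (≡-mod-refl {a = l ℤ.* u}) (≡-mod-sym x≡))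
                    (≡-mod-* (≡-mod-refl {a = m ℤ.* u}) (≡-mod-sym y≡)))
           (≡-mod-* (≡-mod-refl {a = n ℤ.* u}) (≡-mod-sym z≡)))
  (≡-mod-reflexive (factor l m n u (+ x) (+ y) (+ z)))
  where
  factor : ∀ l m n u x y z →
    l ℤ.* u ℤ.* x ℤ.+ m ℤ.* u ℤ.* y ℤ.+ n ℤ.* u ℤ.* z ≡ u ℤ.* (l ℤ.* x ℤ.+ m ℤ.* y ℤ.+ n ℤ.* z)
  factor = solve-∀

module ExponentialSum {c ℓ} (R : CommutativeRing c ℓ) where
  open CommutativeRing R
  open FiniteSums R

  -- The summand `term` of `lam`, so that `lam≈cube-sum` holds by unfolding.
  λ-term : Carrier → ℕ → ℕ → ℕ → ℤ → ℤ → ℤ → ℕ → ℕ → ℕ → Carrier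
  λ-term ζ Q q₁ q₂ l m n x y z =
    if does (q₁ ∣? (quadric x y z ℕ.+ 1)) ∧ does (q₂ ∣? (quadric x y z ℕ.+ 2))
    then eR R ζ Q (linearForm l m n x y z) (q₁ ℕ.* q₂) else 0#

  lam≈cube-sum : ∀ ζ Q q₁ q₂ l m n →
    lam R ζ Q q₁ q₂ l m n ≈ cube-sum (q₁ ℕ.* q₂) (λ x y z → λ-term ζ Q q₁ q₂ l m n (suc x) (suc y) (suc z))
  lam≈cube-sum ζ Q q₁ q₂ l m n = reflexive (≡.trans (sumR-range1 _ N)
    (sum-cong-≗ {N} λ x → ≡.trans (sumR-range1 _ N) (sum-cong-≗ {N} λ y → sumR-range1 (t (suc (toℕ x)) (suc (toℕ y))) N)))
    where
    N = q₁ ℕ.* q₂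
    t = λ-term ζ Q q₁ q₂ l m n

  if-cong : ∀ b {x y} → x ≈ y → (if b then x else 0#) ≈ (if b then y else 0#)
  if-cong true  x≈y = x≈y
  if-cong false _   = refl

  if-∧-* : ∀ b₁ b₂ {x y} → (if b₁ ∧ b₂ then x * y else 0#) ≈ (if b₁ then x else 0#) * (if b₂ then y else 0#)
  if-∧-* true  true  = refl
  if-∧-* true  false = sym (zeroʳ _)
  if-∧-* false _     = sym (zeroˡ _)

module Multiplicativity {c ℓ} (R : CommutativeRing c ℓ) (ζ : CommutativeRing.Carrier R) (q₁ q₂ q₃ q₄ : ℕ)
  .{{_ : NonZero q₁}} .{{_ : NonZero q₂}} .{{_ : NonZero q₃}} .{{_ : NonZero q₄}}
  (q₁⊥q₂ : Coprime q₁ q₂) (q₃⊥q₄ : Coprime q₃ q₄)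
  (ζ^Q≈1 : CommutativeRing._≈_ R (pow R ζ (q₁ ℕ.* q₂ ℕ.* q₃ ℕ.* q₄)) (CommutativeRing.1# R))
  (u v : ℤ) (u-inverse : u ℤ.* + (q₂ ℕ.* q₄) ≡ 1ℤ mod q₁ ℕ.* q₃)
  (v-inverse : v ℤ.* + (q₁ ℕ.* q₃) ≡ 1ℤ mod q₂ ℕ.* q₄)
  (l m n : ℤ) where

  open CommutativeRing R
  open RootsOfUnity R
  open FiniteSums R
  open ExponentialSum R
  open import Relation.Binary.Reasoning.Setoid setoid
  open import Algebra.Properties.CommutativeSemigroup (CommutativeMonoid.commutativeSemigroup ∧-commutativeMonoid)
    using (interchange)

  A B Q : ℕ
  A = q₁ ℕ.* q₃
  B = q₂ ℕ.* q₄
  Q = q₁ ℕ.* q₂ ℕ.* q₃ ℕ.* q₄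

  instance
    _ : NonZero A
    _ = ℕₚ.m*n≢0 q₁ q₃
    _ : NonZero B
    _ = ℕₚ.m*n≢0 q₂ q₄

  open ChineseRemainder A B u v u-inverse v-inverse

  rearrange : ∀ a b c d → a ℕ.* b ℕ.* (c ℕ.* d) ≡ a ℕ.* c ℕ.* (b ℕ.* d)
  rearrange = ℕSolver.solve-∀

  AB≡Q : A ℕ.* B ≡ Q
  AB≡Q = ≡.trans (≡.sym (rearrange q₁ q₂ q₃ q₄)) (≡.sym (ℕₚ.*-assoc (q₁ ℕ.* q₂) q₃ q₄))

  λ-term-split : ∀ {X Y Z X₁ Y₁ Z₁ X₂ Y₂ Z₂} →
    + X ≡ + X₁ mod A → + Y ≡ + Y₁ mod A → + Z ≡ + Z₁ mod A →
    + X ≡ + X₂ mod B → + Y ≡ + Y₂ mod B → + Z ≡ + Z₂ mod B →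
    λ-term ζ Q (q₁ ℕ.* q₂) (q₃ ℕ.* q₄) l m n X Y Z ≈
    λ-term ζ Q q₁ q₃ (l ℤ.* u) (m ℤ.* u) (n ℤ.* u) X₁ Y₁ Z₁ *
    λ-term ζ Q q₂ q₄ (l ℤ.* v) (m ℤ.* v) (n ℤ.* v) X₂ Y₂ Z₂
  λ-term-split {X} {Y} {Z} {X₁} {Y₁} {Z₁} {X₂} {Y₂} {Z₂} X≡X₁ Y≡Y₁ Z≡Z₁ X≡X₂ Y≡Y₂ Z≡Z₂ = begin
    (if does (q₁ ℕ.* q₂ ∣? s ℕ.+ 1) ∧ does (q₃ ℕ.* q₄ ∣? s ℕ.+ 2) then E else 0#)
      ≡⟨ ≡.cong₂ (λ b b′ → if b ∧ b′ then E else 0#) q₁q₂∣s+1 q₃q₄∣s+2 ⟩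
    (if (d₁ ∧ d₂) ∧ (d₃ ∧ d₄) then E else 0#)
      ≡⟨ ≡.cong (λ b → if b then E else 0#) (interchange d₁ d₂ d₃ d₄) ⟩
    (if (d₁ ∧ d₃) ∧ (d₂ ∧ d₄) then E else 0#)
      ≈⟨ if-cong ((d₁ ∧ d₃) ∧ (d₂ ∧ d₄)) E≈E₁E₂ ⟩
    (if (d₁ ∧ d₃) ∧ (d₂ ∧ d₄) then E₁ * E₂ else 0#)
      ≈⟨ if-∧-* (d₁ ∧ d₃) (d₂ ∧ d₄) ⟩
    (if d₁ ∧ d₃ then E₁ else 0#) * (if d₂ ∧ d₄ then E₂ else 0#) ∎
    where
    s = quadric X Y Z
    s₁ = quadric X₁ Y₁ Z₁
    s₂ = quadric X₂ Y₂ Z₂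
    s≡s₁ : ∀ k → + (s ℕ.+ k) ≡ + (s₁ ℕ.+ k) mod A
    s≡s₁ k = ≡-mod-+ (quadric-cong X≡X₁ Y≡Y₁ Z≡Z₁) (≡-mod-refl {a = + k})
    s≡s₂ : ∀ k → + (s ℕ.+ k) ≡ + (s₂ ℕ.+ k) mod B
    s≡s₂ k = ≡-mod-+ (quadric-cong X≡X₂ Y≡Y₂ Z≡Z₂) (≡-mod-refl {a = + k})
    d₁ = does (q₁ ∣? s₁ ℕ.+ 1)
    d₂ = does (q₂ ∣? s₂ ℕ.+ 1)
    d₃ = does (q₃ ∣? s₁ ℕ.+ 2)
    d₄ = does (q₄ ∣? s₂ ℕ.+ 2)
    q₁q₂∣s+1 : does (q₁ ℕ.* q₂ ∣? s ℕ.+ 1) ≡ d₁ ∧ d₂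
    q₁q₂∣s+1 = does-⇔ (∣-*-⇔ q₁⊥q₂ (ℕD.m∣m*n q₃) (ℕD.m∣m*n q₄) (s≡s₁ 1) (s≡s₂ 1))
                      (q₁ ℕ.* q₂ ∣? s ℕ.+ 1) ((q₁ ∣? _) ×-dec (q₂ ∣? _))
    q₃q₄∣s+2 : does (q₃ ℕ.* q₄ ∣? s ℕ.+ 2) ≡ d₃ ∧ d₄
    q₃q₄∣s+2 = does-⇔ (∣-*-⇔ q₃⊥q₄ (ℕD.n∣m*n q₁) (ℕD.n∣m*n q₂) (s≡s₁ 2) (s≡s₂ 2))
                      (q₃ ℕ.* q₄ ∣? s ℕ.+ 2) ((q₃ ∣? _) ×-dec (q₄ ∣? _))
    L = linearForm l m n X Y Z
    E = eR R ζ Q L (q₁ ℕ.* q₂ ℕ.* (q₃ ℕ.* q₄))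
    E₁ = eR R ζ Q (linearForm (l ℤ.* u) (m ℤ.* u) (n ℤ.* u) X₁ Y₁ Z₁) A
    E₂ = eR R ζ Q (linearForm (l ℤ.* v) (m ℤ.* v) (n ℤ.* v) X₂ Y₂ Z₂) B
    E≈E₁E₂ : E ≈ E₁ * E₂
    E≈E₁E₂ = trans (reflexive (≡.cong (eR R ζ Q L) (rearrange q₁ q₂ q₃ q₄)))
      (eR-split ζ^Q≈1 AB≡Q {u} {v} uB+vA≡1
        (linearForm-scale l m n u X≡X₁ Y≡Y₁ Z≡Z₁) (linearForm-scale l m n v X≡X₂ Y≡Y₂ Z≡Z₂))

  lam-multiplicative :
    lam R ζ Q (q₁ ℕ.* q₂) (q₃ ℕ.* q₄) l m n ≈
    lam R ζ Q q₁ q₃ (l ℤ.* u) (m ℤ.* u) (n ℤ.* u) * lam R ζ Q q₂ q₄ (l ℤ.* v) (m ℤ.* v) (n ℤ.* v)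
  lam-multiplicative = begin
    lam R ζ Q (q₁ ℕ.* q₂) (q₃ ℕ.* q₄) l m n
      ≈⟨ lam≈cube-sum ζ Q (q₁ ℕ.* q₂) (q₃ ℕ.* q₄) l m n ⟩
    cube-sum (q₁ ℕ.* q₂ ℕ.* (q₃ ℕ.* q₄)) T
      ≡⟨ ≡.cong (λ N → cube-sum N T) (rearrange q₁ q₂ q₃ q₄) ⟩
    cube-sum (A ℕ.* B) T
      ≈⟨ cube-sum-cong (A ℕ.* B) (λ x y z → λ-term-split (suc≡ x) (suc≡ y) (suc≡ z) (suc≡ x) (suc≡ y) (suc≡ z)) ⟩
    cube-sum (A ℕ.* B) (λ x y z → t₁ (x % A) (y % A) (z % A) * t₂ (x % B) (y % B) (z % B))
      ≈⟨ cube-sum-crt R t₁ t₂ ⟩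
    cube-sum A t₁ * cube-sum B t₂
      ≈⟨ *-cong (lam≈cube-sum ζ Q q₁ q₃ (l ℤ.* u) (m ℤ.* u) (n ℤ.* u))
                (lam≈cube-sum ζ Q q₂ q₄ (l ℤ.* v) (m ℤ.* v) (n ℤ.* v)) ⟨
    lam R ζ Q q₁ q₃ (l ℤ.* u) (m ℤ.* u) (n ℤ.* u) * lam R ζ Q q₂ q₄ (l ℤ.* v) (m ℤ.* v) (n ℤ.* v) ∎
    where
    T t₁ t₂ : ℕ → ℕ → ℕ → Carrier
    T x y z = λ-term ζ Q (q₁ ℕ.* q₂) (q₃ ℕ.* q₄) l m n (suc x) (suc y) (suc z)
    t₁ x y z = λ-term ζ Q q₁ q₃ (l ℤ.* u) (m ℤ.* u) (n ℤ.* u) (suc x) (suc y) (suc z)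
    t₂ x y z = λ-term ζ Q q₂ q₄ (l ℤ.* v) (m ℤ.* v) (n ℤ.* v) (suc x) (suc y) (suc z)
    suc≡ : ∀ {d} .{{_ : NonZero d}} x → + suc x ≡ + suc (x % d) mod d
    suc≡ x = ≡-mod-+ (≡-mod-refl {a = + 1}) (≡-mod-sym (%ℕ-≡-mod (+ x)))

open import Data.Nat using (_*_)

-- Coprimality of q₁q₂ and q₃q₄ only guarantees that u and v exist.
mainTheorem3 : ∀ {c ℓ} (R : CommutativeRing c ℓ) (ζ : CommutativeRing.Carrier R)
  (q₁ q₂ q₃ q₄ : ℕ) → 0 < q₁ → 0 < q₂ → 0 < q₃ → 0 < q₄ →
  Coprime (q₁ * q₂) (q₃ * q₄) → Coprime q₁ q₂ → Coprime q₃ q₄ →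
  CommutativeRing._≈_ R (pow R ζ (q₁ * q₂ * q₃ * q₄)) (CommutativeRing.1# R) →
  (l m n u v : ℤ) →
  (+ (q₁ * q₃)) ℤD.∣ (u ℤ.* + (q₂ * q₄) ℤ.- 1ℤ) →
  (+ (q₂ * q₄)) ℤD.∣ (v ℤ.* + (q₁ * q₃) ℤ.- 1ℤ) →
  CommutativeRing._≈_ R
    (lam R ζ (q₁ * q₂ * q₃ * q₄) (q₁ * q₂) (q₃ * q₄) l m n)
    (CommutativeRing._*_ R
      (lam R ζ (q₁ * q₂ * q₃ * q₄) q₁ q₃ (l ℤ.* u) (m ℤ.* u) (n ℤ.* u))
      (lam R ζ (q₁ * q₂ * q₃ * q₄) q₂ q₄ (l ℤ.* v) (m ℤ.* v) (n ℤ.* v)))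
mainTheorem3 R ζ q₁ q₂ q₃ q₄ 0<q₁ 0<q₂ 0<q₃ 0<q₄ _ q₁⊥q₂ q₃⊥q₄ ζ^Q≈1 l m n u v u-inverse v-inverse =
  Multiplicativity.lam-multiplicative R ζ q₁ q₂ q₃ q₄
    {{ℕ.>-nonZero 0<q₁}} {{ℕ.>-nonZero 0<q₂}} {{ℕ.>-nonZero 0<q₃}} {{ℕ.>-nonZero 0<q₄}}
    q₁⊥q₂ q₃⊥q₄ ζ^Q≈1 u v (≡-mod (ℤS.∣ᵤ⇒∣ u-inverse)) (≡-mod (ℤS.∣ᵤ⇒∣ v-inverse)) l m n
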